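{- Let $f(X)=X^3+c_2X^2+c_1X+c_0\in\mathbb{Z}[X]$ be irreducible, and let $r$ be a root of $f$. Let $\alpha=a_0+a_1r+a_2r^2\in\mathbb{Z}[r]$ with $$(N(\alpha),\,B_{13}\,\mathrm{Disc}(f))=1.$$ Then: (i) There is an integer $0\le k_\alpha<N(\alpha)$ such that, for all $n\in\mathbb{Z}$, $n-r\equiv 0\pmod{\alpha}$ if and only if $n\equiv k_\alpha\pmod{N(\alpha)}$. (ii) Moreover $k_\alpha\equiv B_{23}\overline{B_{13}}\pmod{N(\alpha)}$. (iii) If $J$ is an ideal of $\mathbb{Z}[r]$ containing the principal ideal $(\alpha)$ for such an $\alpha$, then there is an integer $0\le k_J<N(J)$ such that, for all $n\in\mathbb{Z}$, $n-r\equiv 0 \pmod J$ if and only if $n\equiv k_J\pmod{N(J)}$.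
   Context: $M_\alpha$ is the matrix of multiplication by $\alpha$ on $\mathbb{Q}(r)$ in the basis $\{1,r,r^2\}$: $$M_\alpha=\begin{pmatrix} a_0 & -c_0a_2 & a_2c_0c_2 - a_1c_0\\ a_1 & a_0-c_1a_2 & a_2c_1c_2 - a_2c_0 - a_1c_1\\ a_2 & a_1-c_2a_2 & a_2c_2^2 - a_2c_1 - a_1c_2 + a_0 \end{pmatrix}.$$ $N(\alpha)=\det M_\alpha$ is the norm of $\alpha$. $B_{ij}=B_{ij}(a_0,a_1,a_2)$ is the $(i,j)$ cofactor of $M_\alpha$, that is, $(-1)^{i+j}$ times the determinant of the matrix obtained from $M_\alpha$ by deleting row $i$ and column $j$. $\overline{B_{13}}$ denotes an inverse of $B_{13}$ modulo $N(\alpha)$. $N(J)=\#(\mathbb{Z}[r]/J)$ for an ideal $J$. -}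

module Defs where

open import Data.Nat as ℕ using (ℕ; zero; suc)
open import Data.Integer using (ℤ; +_; -_; _+_; _-_; _*_; ∣_∣)
open import Data.Integer.Divisibility using (_∣_)
open import Data.Fin using (Fin)
open import Data.List using (List; []; _∷_)
open import Data.Product using (Σ; ∃; _×_; _,_)
open import Data.Sum using (_⊎_)
open import Relation.Binary.PropositionalEquality using (_≡_)

-- Polynomials over ℤ, as coefficient lists (lowest degree first;
-- coefficients beyond the list are 0).

Poly : Set
Poly = List ℤ

coeff : Poly → ℕ → ℤ
coeff []       _       = + 0
coeff (a ∷ _)  zero    = a
coeff (_ ∷ as) (suc n) = coeff as n

convAux : Poly → Poly → ℕ → ℕ → ℤ
convAux g h zero    n = coeff g 0 * coeff h n
convAux g h (suc i) n = coeff g (suc i) * coeff h (n ℕ.∸ suc i) + convAux g h i n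

mulCoeff : Poly → Poly → ℕ → ℤ
mulCoeff g h n = convAux g h n n

IsProduct : Poly → Poly → Poly → Set
IsProduct f g h = ∀ n → coeff f n ≡ mulCoeff g h n

IsUnitPoly : Poly → Set
IsUnitPoly g = (coeff g 0 ≡ + 1 ⊎ coeff g 0 ≡ - (+ 1)) × (∀ n → coeff g (suc n) ≡ + 0)

-- irreducible in ℤ[X] (f is assumed monic cubic, hence nonzero non-unit):
-- every factorisation has a unit factor
IrreducibleZ : Poly → Set
IrreducibleZ f = ∀ g h → IsProduct f g h → IsUnitPoly g ⊎ IsUnitPoly h

cubic : ℤ → ℤ → ℤ → Poly
cubic c₀ c₁ c₂ = c₀ ∷ c₁ ∷ c₂ ∷ + 1 ∷ []

disc : ℤ → ℤ → ℤ → ℤ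
disc c₀ c₁ c₂ =
  c₂ * c₂ * c₁ * c₁ - + 4 * c₁ * c₁ * c₁ - + 4 * c₂ * c₂ * c₂ * c₀
  - + 27 * c₀ * c₀ + + 18 * c₂ * c₁ * c₀

-- ℤ[r] ≅ ℤ[X]/(f), elements a₀ + a₁ r + a₂ r² in the basis {1, r, r²}

record Zr : Set where
  constructor ⟨_,_,_⟩
  field
    a₀ a₁ a₂ : ℤ

module _ (c₀ c₁ c₂ : ℤ) where

  M : Zr → Fin 3 → Fin 3 → ℤ
  M ⟨ a₀ , a₁ , a₂ ⟩ Fin.zero Fin.zero = a₀
  M ⟨ a₀ , a₁ , a₂ ⟩ Fin.zero (Fin.suc Fin.zero) = - (c₀ * a₂)
  M ⟨ a₀ , a₁ , a₂ ⟩ Fin.zero (Fin.suc (Fin.suc Fin.zero)) = a₂ * c₀ * c₂ - a₁ * c₀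
  M ⟨ a₀ , a₁ , a₂ ⟩ (Fin.suc Fin.zero) Fin.zero = a₁
  M ⟨ a₀ , a₁ , a₂ ⟩ (Fin.suc Fin.zero) (Fin.suc Fin.zero) = a₀ - c₁ * a₂
  M ⟨ a₀ , a₁ , a₂ ⟩ (Fin.suc Fin.zero) (Fin.suc (Fin.suc Fin.zero)) =
    a₂ * c₁ * c₂ - a₂ * c₀ - a₁ * c₁
  M ⟨ a₀ , a₁ , a₂ ⟩ (Fin.suc (Fin.suc Fin.zero)) Fin.zero = a₂
  M ⟨ a₀ , a₁ , a₂ ⟩ (Fin.suc (Fin.suc Fin.zero)) (Fin.suc Fin.zero) = a₁ - c₂ * a₂
  M ⟨ a₀ , a₁ , a₂ ⟩ (Fin.suc (Fin.suc Fin.zero)) (Fin.suc (Fin.suc Fin.zero)) =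
    a₂ * c₂ * c₂ - a₂ * c₁ - a₁ * c₂ + a₀

  private
    m : Zr → ℕ → ℕ → ℤ
    m α 0 0 = M α Fin.zero Fin.zero
    m α 0 1 = M α Fin.zero (Fin.suc Fin.zero)
    m α 0 _ = M α Fin.zero (Fin.suc (Fin.suc Fin.zero))
    m α 1 0 = M α (Fin.suc Fin.zero) Fin.zero
    m α 1 1 = M α (Fin.suc Fin.zero) (Fin.suc Fin.zero)
    m α 1 _ = M α (Fin.suc Fin.zero) (Fin.suc (Fin.suc Fin.zero))
    m α _ 0 = M α (Fin.suc (Fin.suc Fin.zero)) Fin.zero
    m α _ 1 = M α (Fin.suc (Fin.suc Fin.zero)) (Fin.suc Fin.zero)
    m α _ _ = M α (Fin.suc (Fin.suc Fin.zero)) (Fin.suc (Fin.suc Fin.zero))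

  norm : Zr → ℤ
  norm α =
      m α 0 0 * (m α 1 1 * m α 2 2 - m α 1 2 * m α 2 1)
    - m α 0 1 * (m α 1 0 * m α 2 2 - m α 1 2 * m α 2 0)
    + m α 0 2 * (m α 1 0 * m α 2 1 - m α 1 1 * m α 2 0)

  -- cofactors B₁₃ and B₂₃ (1-indexed, as in the paper)
  B₁₃ : Zr → ℤ
  B₁₃ α = m α 1 0 * m α 2 1 - m α 1 1 * m α 2 0

  B₂₃ : Zr → ℤ
  B₂₃ α = - (m α 0 0 * m α 2 1 - m α 0 1 * m α 2 0)

  -- ring operations on ℤ[r]; α·β = M_α β
  infixl 7 _·_
  _·_ : Zr → Zr → Zr
  α · ⟨ b₀ , b₁ , b₂ ⟩ =
    ⟨ m α 0 0 * b₀ + m α 0 1 * b₁ + m α 0 2 * b₂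
    , m α 1 0 * b₀ + m α 1 1 * b₁ + m α 1 2 * b₂
    , m α 2 0 * b₀ + m α 2 1 * b₁ + m α 2 2 * b₂ ⟩

infixl 6 _⊕_ _⊖_
_⊕_ : Zr → Zr → Zr
⟨ a , b , c ⟩ ⊕ ⟨ a' , b' , c' ⟩ = ⟨ a + a' , b + b' , c + c' ⟩

_⊖_ : Zr → Zr → Zr
⟨ a , b , c ⟩ ⊖ ⟨ a' , b' , c' ⟩ = ⟨ a - a' , b - b' , c - c' ⟩

zeroZr : Zr
zeroZr = ⟨ + 0 , + 0 , + 0 ⟩

nMinusR : ℤ → Zr
nMinusR n = ⟨ n , - (+ 1) , + 0 ⟩

module _ (c₀ c₁ c₂ : ℤ) where

  DividesZr : Zr → Zr → Set
  DividesZr α x = ∃ λ β → _·_ c₀ c₁ c₂ α β ≡ x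

  record IsIdeal (J : Zr → Set) : Set where
    field
      zero∈ : J zeroZr
      +∈    : ∀ x y → J x → J y → J (x ⊕ y)
      ·∈    : ∀ x y → J y → J (_·_ c₀ c₁ c₂ x y)

  -- N(J) = #(ℤ[r]/J) = N: an enumeration Fin N → ℤ[r] of a complete
  -- system of representatives of ℤ[r]/J, each class hit exactly once
  HasIndex : (Zr → Set) → ℕ → Set
  HasIndex J N =
    Σ (Fin N → Zr) λ g →
      (∀ x → ∃ λ i → J (x ⊖ g i)) ×
      (∀ i j → J (g i ⊖ g j) → i ≡ j)

infix 4 _≡_[mod_]
_≡_[mod_] : ℤ → ℤ → ℤ → Set
a ≡ b [mod n ] = n ∣ (a - b)

-- Write α·β = M_α β. Then α ∣ n − r says that M_α x = (n, −1, 0) has an integral solution. The third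
-- row of adj(M_α)·M_α = N·I shows that a solution forces N ∣ B₁₃ n − B₂₃. Conversely, the 2 × 2 minors
-- of adj(M_α) are N times entries of M_α, so once N ∣ B₁₃ n − B₂₃ and B₁₃ is prime to N, N divides the
-- whole column adj(M_α)·(n, −1, 0), and that column divided by N is a solution. As B₁₃ is a unit mod N,
-- the criterion reads n ≡ B₂₃ B̄₁₃ (mod N).
-- N ≠ 0 comes from the coprimality hypothesis alone: N = 0 would force B₁₃ Δ = ±1, but Δ = ±1 makes f
-- irreducible mod 2, so ℤ[r]/2 ≅ F₈, and an odd B₁₃ then makes N odd.
-- For (iii), α ∣ k − r puts k − r in J, which makes every element of ℤ[r] congruent mod J to an
-- integer. So ℤ → ℤ[r]/J is onto, and counting classes gives J ∩ ℤ = N(J) ℤ.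
module Submission where

open import Defs
open import Data.Nat as ℕ using (ℕ; zero; suc)
import Data.Nat.Properties as ℕ
import Data.Nat.Divisibility as ℕ
open import Data.Nat.GCD using (module Bézout)
open import Data.Nat.Coprimality using (Coprime; coprime-Bézout; 0-coprimeTo-m⇒m≡1)
open import Data.Integer using (ℤ; +_; -_; -[1+_]; _+_; _-_; _*_; ∣_∣; _≤_; _<_; +≤+; +<+; NonZero; ≢-nonZero)
open import Data.Integer.Properties
  using (pos-+; pos-*; abs-*; *-comm; *-cancelˡ-≡; *-zeroʳ; +-identityʳ; [+m]-[+n]≡m⊖n; ⊖-≥)
open import Data.Integer.Coprimality using (coprime-divisor)
open import Data.Integer.DivMod using (_%ℕ_; _/ℕ_; a≡a%ℕn+[a/ℕn]*n; n%ℕd<d)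
open import Data.Integer.Divisibility.Signed
  using (_∣_; _∣?_; divides; ∣ᵤ⇒∣; ∣⇒∣ᵤ; ∣-refl; ∣-trans; m∣∣m∣; ∣m∣n⇒∣m+n; ∣m∣n⇒∣m-n; ∣n⇒∣m*n; ∣m⇒∣m*n; ∣m⇒∣-m)
open import Data.Integer.Tactic.RingSolver using (solve-∀)
open import Data.Fin using (Fin; toℕ; fromℕ<)
open import Data.Fin.Patterns using (0F; 1F; 2F; 3F; 4F; 5F)
open import Data.Fin.Properties using (all?; pigeonhole; injective⇒≤; nonZeroIndex; toℕ-fromℕ<; toℕ<n)
open import Data.Vec using (Vec; []; _∷_; lookup)
open import Data.Vec.Relation.Binary.Pointwise.Inductive as Pointwise using (Pointwise; []; _∷_)
open import Data.Empty using (⊥-elim)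
open import Data.Product using (∃; _×_; _,_; proj₁; proj₂)
open import Data.Sum as Sum using (_⊎_; inj₁; inj₂)
open import Function.Base using (_∘_)
open import Function.Bundles using (_⇔_; mk⇔; Equivalence)
open import Function.Properties.Equivalence using () renaming (trans to ⇔-trans; sym to ⇔-sym)
open import Relation.Nullary using (¬_; Dec)
open import Relation.Nullary.Decidable using (¬?; _×-dec_; _⊎-dec_; _→-dec_; toWitness)
open import Relation.Binary.PropositionalEquality
  using (_≡_; _≢_; refl; sym; trans; cong; subst; module ≡-Reasoning)
open Equivalence using (to; from)

-- Congruences of integers

≡mod⇔∣ : ∀ a b n → a ≡ b [mod n ] ⇔ n ∣ a - b
≡mod⇔∣ a b n = mk⇔ (∣ᵤ⇒∣ {n} {a - b}) (∣⇒∣ᵤ {n} {a - b})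

x≡y⇒∣x-y : ∀ {m} x y → x ≡ y → m ∣ x - y
x≡y⇒∣x-y {m} x _ refl = divides (+ 0) (identity x m)
  where
  identity : ∀ x m → x - x ≡ + 0 * m
  identity = solve-∀

∣m-n⇒∣n-m : ∀ {d} m n → d ∣ m - n → d ∣ n - m
∣m-n⇒∣n-m m n = subst (_ ∣_) (identity m n) ∘ ∣m⇒∣-m
  where
  identity : ∀ m n → - (m - n) ≡ n - m
  identity = solve-∀

∣m-n∣n-o⇒∣m-o : ∀ {d} m n o → d ∣ m - n → d ∣ n - o → d ∣ m - o
∣m-n∣n-o⇒∣m-o m n o d∣m-n d∣n-o = subst (_ ∣_) (identity m n o) (∣m∣n⇒∣m+n d∣m-n d∣n-o)
  where
  identity : ∀ m n o → (m - n) + (n - o) ≡ m - o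
  identity = solve-∀

∣m-n⇒∣o-m⇔∣o-n : ∀ {d} m n o → d ∣ m - n → (d ∣ o - m) ⇔ (d ∣ o - n)
∣m-n⇒∣o-m⇔∣o-n m n o d∣m-n =
  mk⇔ (λ d∣o-m → ∣m-n∣n-o⇒∣m-o o m n d∣o-m d∣m-n)
      (λ d∣o-n → ∣m-n∣n-o⇒∣m-o o n m d∣o-n (∣m-n⇒∣n-m m n d∣m-n))

n∣a-a%ℕn : ∀ a n .{{_ : ℕ.NonZero n}} → + n ∣ a - + (a %ℕ n)
n∣a-a%ℕn a n = divides (a /ℕ n) (begin
  a - + (a %ℕ n)                           ≡⟨ cong (_- + (a %ℕ n)) (a≡a%ℕn+[a/ℕn]*n a n) ⟩
  + (a %ℕ n) + (a /ℕ n) * + n - + (a %ℕ n) ≡⟨ identity (+ (a %ℕ n)) (a /ℕ n * + n) ⟩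
  a /ℕ n * + n                             ∎)
  where
  open ≡-Reasoning
  identity : ∀ r m → r + m - r ≡ m
  identity = solve-∀

residue : ∀ m .{{_ : ℕ.NonZero m}} a → ∃ λ (i : Fin m) → + m ∣ a - + toℕ i
residue m a = fromℕ< (n%ℕd<d a m) , subst (λ r → + m ∣ a - + r) (sym (toℕ-fromℕ< _)) (n∣a-a%ℕn a m)

unit-∣⇔ : ∀ {m} u ū v n → m ∣ u * ū - + 1 → (m ∣ u * n - v) ⇔ (m ∣ n - v * ū)
unit-∣⇔ {m} u ū v n m∣uū-1 = mk⇔
  (λ m∣un-v → subst (m ∣_) (cancel u ū v n)
     (∣m∣n⇒∣m+n (∣n⇒∣m*n ū m∣un-v) (∣n⇒∣m*n (- n) m∣uū-1)))
  (λ m∣n-vū → subst (m ∣_) (uncancel u ū v n)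
     (∣m∣n⇒∣m+n (∣n⇒∣m*n u m∣n-vū) (∣n⇒∣m*n v m∣uū-1)))
  where
  cancel : ∀ u ū v n → ū * (u * n - v) + - n * (u * ū - + 1) ≡ n - v * ū
  cancel = solve-∀
  uncancel : ∀ u ū v n → u * (n - v * ū) + v * (u * ū - + 1) ≡ u * n - v
  uncancel = solve-∀

pos-+* : ∀ a b c d e → a ℕ.+ b ℕ.* c ≡ d ℕ.* e → + a + + b * + c ≡ + d * + e
pos-+* a b c d e eq = begin
  + a + + b * + c   ≡⟨ cong (_+_ (+ a)) (pos-* b c) ⟨
  + a + + (b ℕ.* c) ≡⟨ pos-+ a (b ℕ.* c) ⟨
  + (a ℕ.+ b ℕ.* c) ≡⟨ cong +_ eq ⟩
  + (d ℕ.* e)       ≡⟨ pos-* d e ⟩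
  + d * + e         ∎
  where open ≡-Reasoning

coprime⇒inverse : ∀ m u → Coprime ∣ m ∣ ∣ u ∣ → ∃ λ ū → m ∣ u * ū - + 1
coprime⇒inverse m u cop with m∣∣m∣ {u} | coprime-Bézout cop
... | divides s ∣u∣≡su | Bézout.+- x y 1+y∣u∣≡x∣m∣ = - (+ y * s) , subst (m ∣_) (begin
  - (+ x * + ∣ m ∣)       ≡⟨ cong -_ (pos-+* 1 y (∣ u ∣) x (∣ m ∣) 1+y∣u∣≡x∣m∣) ⟨
  - (+ 1 + + y * + ∣ u ∣) ≡⟨ cong (λ t → - (+ 1 + + y * t)) ∣u∣≡su ⟩
  - (+ 1 + + y * (s * u)) ≡⟨ identity (+ y) s u ⟩
  u * - (+ y * s) - + 1   ∎) (∣m⇒∣-m (∣n⇒∣m*n (+ x) m∣∣m∣))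
  where
  open ≡-Reasoning
  identity : ∀ y s u → - (+ 1 + y * (s * u)) ≡ u * - (y * s) - + 1
  identity = solve-∀
... | divides s ∣u∣≡su | Bézout.-+ x y 1+x∣m∣≡y∣u∣ = + y * s , subst (m ∣_) (begin
  + x * + ∣ m ∣           ≡⟨ identity (+ 1) (+ x * + ∣ m ∣) ⟩
  + 1 + + x * + ∣ m ∣ - + 1 ≡⟨ cong (_- + 1) (pos-+* 1 x (∣ m ∣) y (∣ u ∣) 1+x∣m∣≡y∣u∣) ⟩
  + y * + ∣ u ∣ - + 1     ≡⟨ cong (λ t → + y * t - + 1) ∣u∣≡su ⟩
  + y * (s * u) - + 1     ≡⟨ identity′ (+ y) s u ⟩
  u * (+ y * s) - + 1     ∎) (∣n⇒∣m*n (+ x) m∣∣m∣)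
  where
  open ≡-Reasoning
  identity : ∀ a b → b ≡ a + b - a
  identity = solve-∀
  identity′ : ∀ y s u → y * (s * u) - + 1 ≡ u * (y * s) - + 1
  identity′ = solve-∀

+toℕ-bounds : ∀ {m} (i : Fin m) → + 0 ≤ + toℕ i × + toℕ i < + m
+toℕ-bounds i = +≤+ ℕ.z≤n , +<+ (toℕ<n i)

coprime-*ʳ⇒coprime : ∀ m n o → Coprime ∣ m ∣ ∣ n * o ∣ → Coprime ∣ m ∣ ∣ n ∣
coprime-*ʳ⇒coprime m n o cop (d∣m , d∣n) =
  cop (d∣m , subst (_ ℕ.∣_) (sym (abs-* n o)) (ℕ.∣-trans d∣n (ℕ.m∣m*n ∣ o ∣)))

-- Vectors and 3 × 3 matrices over ℤ

cong₃ : ∀ {x₀ x₁ x₂ y₀ y₁ y₂} → x₀ ≡ y₀ → x₁ ≡ y₁ → x₂ ≡ y₂ → ⟨ x₀ , x₁ , x₂ ⟩ ≡ ⟨ y₀ , y₁ , y₂ ⟩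
cong₃ refl refl refl = refl

infixr 7 _·ₛ_
_·ₛ_ : ℤ → Zr → Zr
d ·ₛ ⟨ x₀ , x₁ , x₂ ⟩ = ⟨ d * x₀ , d * x₁ , d * x₂ ⟩

·ₛ-cancel : ∀ d {x y} .{{_ : NonZero d}} → d ·ₛ x ≡ d ·ₛ y → x ≡ y
·ₛ-cancel d {⟨ x₀ , x₁ , x₂ ⟩} {⟨ y₀ , y₁ , y₂ ⟩} eq = cong₃
  (*-cancelˡ-≡ d x₀ y₀ (cong Zr.a₀ eq))
  (*-cancelˡ-≡ d x₁ y₁ (cong Zr.a₁ eq))
  (*-cancelˡ-≡ d x₂ y₂ (cong Zr.a₂ eq))

record Matrix₃ : Set where
  constructor matrix
  field a b c d e f g h i : ℤ

infixr 7 _·ᵥ_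
_·ᵥ_ : Matrix₃ → Zr → Zr
matrix a b c d e f g h i ·ᵥ ⟨ x₀ , x₁ , x₂ ⟩ =
  ⟨ a * x₀ + b * x₁ + c * x₂ , d * x₀ + e * x₁ + f * x₂ , g * x₀ + h * x₁ + i * x₂ ⟩

det cof₁₁ cof₁₂ cof₁₃ cof₂₁ cof₂₂ cof₂₃ cof₃₃ : Matrix₃ → ℤ
det (matrix a b c d e f g h i) = a * (e * i - f * h) - b * (d * i - f * g) + c * (d * h - e * g)
cof₁₁ (matrix a b c d e f g h i) = e * i - f * h
cof₁₂ (matrix a b c d e f g h i) = - (d * i - f * g)
cof₁₃ (matrix a b c d e f g h i) = d * h - e * g
cof₂₁ (matrix a b c d e f g h i) = - (b * i - c * h)
cof₂₂ (matrix a b c d e f g h i) = a * i - c * g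
cof₂₃ (matrix a b c d e f g h i) = - (a * h - b * g)
cof₃₃ (matrix a b c d e f g h i) = a * e - b * d

adj·nMinusR : Matrix₃ → ℤ → Zr
adj·nMinusR A n = ⟨ cof₁₁ A * n - cof₂₁ A , cof₁₂ A * n - cof₂₂ A , cof₁₃ A * n - cof₂₃ A ⟩

·ᵥ-·ₛ : ∀ A t x → A ·ᵥ (t ·ₛ x) ≡ t ·ₛ (A ·ᵥ x)
·ᵥ-·ₛ (matrix a b c d e f g h i) t ⟨ x₀ , x₁ , x₂ ⟩ =
  cong₃ (row a b c t x₀ x₁ x₂) (row d e f t x₀ x₁ x₂) (row g h i t x₀ x₁ x₂)
  where
  row : ∀ p q r t x₀ x₁ x₂ → p * (t * x₀) + q * (t * x₁) + r * (t * x₂) ≡ t * (p * x₀ + q * x₁ + r * x₂)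
  row = solve-∀

cramer₃ : ∀ A x → let y = A ·ᵥ x in
  cof₁₃ A * Zr.a₀ y + cof₂₃ A * Zr.a₁ y + cof₃₃ A * Zr.a₂ y ≡ det A * Zr.a₂ x
cramer₃ (matrix a b c d e f g h i) ⟨ x₀ , x₁ , x₂ ⟩ = identity a b c d e f g h i x₀ x₁ x₂
  where
  identity : ∀ a b c d e f g h i x₀ x₁ x₂ →
      (d * h - e * g) * (a * x₀ + b * x₁ + c * x₂) + (- (a * h - b * g)) * (d * x₀ + e * x₁ + f * x₂)
    + (a * e - b * d) * (g * x₀ + h * x₁ + i * x₂)
    ≡ (a * (e * i - f * h) - b * (d * i - f * g) + c * (d * h - e * g)) * x₂
  identity = solve-∀

·ᵥ-adj·nMinusR : ∀ A n → A ·ᵥ adj·nMinusR A n ≡ det A ·ₛ nMinusR n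
·ᵥ-adj·nMinusR (matrix a b c d e f g h i) n =
  cong₃ (row₁ a b c d e f g h i n) (row₂ a b c d e f g h i n) (row₃ a b c d e f g h i n)
  where
  row₁ : ∀ a b c d e f g h i n →
      a * ((e * i - f * h) * n - (- (b * i - c * h))) + b * ((- (d * i - f * g)) * n - (a * i - c * g))
    + c * ((d * h - e * g) * n - (- (a * h - b * g)))
    ≡ (a * (e * i - f * h) - b * (d * i - f * g) + c * (d * h - e * g)) * n
  row₁ = solve-∀
  row₂ : ∀ a b c d e f g h i n →
      d * ((e * i - f * h) * n - (- (b * i - c * h))) + e * ((- (d * i - f * g)) * n - (a * i - c * g))
    + f * ((d * h - e * g) * n - (- (a * h - b * g)))
    ≡ (a * (e * i - f * h) - b * (d * i - f * g) + c * (d * h - e * g)) * - (+ 1)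
  row₂ = solve-∀
  row₃ : ∀ a b c d e f g h i n →
      g * ((e * i - f * h) * n - (- (b * i - c * h))) + h * ((- (d * i - f * g)) * n - (a * i - c * g))
    + i * ((d * h - e * g) * n - (- (a * h - b * g)))
    ≡ (a * (e * i - f * h) - b * (d * i - f * g) + c * (d * h - e * g)) * + 0
  row₃ = solve-∀

adj-minor₁ : ∀ A → cof₁₁ A * cof₂₃ A - cof₁₃ A * cof₂₁ A ≡ det A * - Matrix₃.h A
adj-minor₁ (matrix a b c d e f g h i) = identity a b c d e f g h i
  where
  identity : ∀ a b c d e f g h i →
    (e * i - f * h) * (- (a * h - b * g)) - (d * h - e * g) * (- (b * i - c * h))
    ≡ (a * (e * i - f * h) - b * (d * i - f * g) + c * (d * h - e * g)) * - h
  identity = solve-∀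

adj-minor₂ : ∀ A → cof₁₂ A * cof₂₃ A - cof₁₃ A * cof₂₂ A ≡ det A * Matrix₃.g A
adj-minor₂ (matrix a b c d e f g h i) = identity a b c d e f g h i
  where
  identity : ∀ a b c d e f g h i →
    (- (d * i - f * g)) * (- (a * h - b * g)) - (d * h - e * g) * (a * i - c * g)
    ≡ (a * (e * i - f * h) - b * (d * i - f * g) + c * (d * h - e * g)) * g
  identity = solve-∀

∣-·ₛ : ∀ {d x₀ x₁ x₂} → d ∣ x₀ → d ∣ x₁ → d ∣ x₂ → ∃ λ y → ⟨ x₀ , x₁ , x₂ ⟩ ≡ d ·ₛ y
∣-·ₛ {d} (divides q₀ refl) (divides q₁ refl) (divides q₂ refl) =
  ⟨ q₀ , q₁ , q₂ ⟩ , cong₃ (*-comm q₀ d) (*-comm q₁ d) (*-comm q₂ d)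

∣-cofactor-row : ∀ {D} u w v z {t} n → Coprime ∣ D ∣ ∣ u ∣ → D ∣ u * n - w → v * w - u * z ≡ D * t →
  D ∣ v * n - z
∣-cofactor-row {D} u w v z {t} n cop D∣un-w minor =
  ∣ᵤ⇒∣ (coprime-divisor D u (v * n - z) cop (∣⇒∣ᵤ (subst (D ∣_) (sym expand) D∣sum)))
  where
  D∣sum : D ∣ v * (u * n - w) + D * t
  D∣sum = ∣m∣n⇒∣m+n (∣n⇒∣m*n v D∣un-w) (∣m⇒∣m*n t ∣-refl)
  expand : u * (v * n - z) ≡ v * (u * n - w) + D * t
  expand = trans (identity u v w z n) (cong (_+_ (v * (u * n - w))) minor)
    where
    identity : ∀ u v w z n → u * (v * n - z) ≡ v * (u * n - w) + (v * w - u * z)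
    identity = solve-∀

solvable⇔ : ∀ A n .{{_ : NonZero (det A)}} → Coprime ∣ det A ∣ ∣ cof₁₃ A ∣ →
  (∃ λ x → A ·ᵥ x ≡ nMinusR n) ⇔ det A ∣ cof₁₃ A * n - cof₂₃ A
solvable⇔ A n cop = mk⇔ necessary (λ D∣z₂ → solution (∣-·ₛ (D∣z₀ D∣z₂) (D∣z₁ D∣z₂) D∣z₂))
  where
  open ≡-Reasoning
  necessary : (∃ λ x → A ·ᵥ x ≡ nMinusR n) → det A ∣ cof₁₃ A * n - cof₂₃ A
  necessary (x , Ax≡n-r) = divides (Zr.a₂ x) (begin
    cof₁₃ A * n - cof₂₃ A
      ≡⟨ identity (cof₁₃ A) (cof₂₃ A) (cof₃₃ A) n ⟩
    cof₁₃ A * n + cof₂₃ A * - (+ 1) + cof₃₃ A * + 0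
      ≡⟨ cong (λ y → cof₁₃ A * Zr.a₀ y + cof₂₃ A * Zr.a₁ y + cof₃₃ A * Zr.a₂ y) (sym Ax≡n-r) ⟩
    cof₁₃ A * Zr.a₀ (A ·ᵥ x) + cof₂₃ A * Zr.a₁ (A ·ᵥ x) + cof₃₃ A * Zr.a₂ (A ·ᵥ x)
      ≡⟨ cramer₃ A x ⟩
    det A * Zr.a₂ x
      ≡⟨ *-comm (det A) (Zr.a₂ x) ⟩
    Zr.a₂ x * det A ∎)
    where
    identity : ∀ u w v n → u * n - w ≡ u * n + w * - (+ 1) + v * + 0
    identity = solve-∀
  D∣z₀ : det A ∣ cof₁₃ A * n - cof₂₃ A → det A ∣ cof₁₁ A * n - cof₂₁ A
  D∣z₀ D∣z₂ = ∣-cofactor-row (cof₁₃ A) (cof₂₃ A) (cof₁₁ A) (cof₂₁ A) n cop D∣z₂ (adj-minor₁ A)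
  D∣z₁ : det A ∣ cof₁₃ A * n - cof₂₃ A → det A ∣ cof₁₂ A * n - cof₂₂ A
  D∣z₁ D∣z₂ = ∣-cofactor-row (cof₁₃ A) (cof₂₃ A) (cof₁₂ A) (cof₂₂ A) n cop D∣z₂ (adj-minor₂ A)
  solution : (∃ λ x → adj·nMinusR A n ≡ det A ·ₛ x) → ∃ λ x → A ·ᵥ x ≡ nMinusR n
  solution (x , z≡Dx) = x , ·ₛ-cancel (det A) (begin
    det A ·ₛ (A ·ᵥ x)        ≡⟨ ·ᵥ-·ₛ A (det A) x ⟨
    A ·ᵥ (det A ·ₛ x)        ≡⟨ cong (A ·ᵥ_) z≡Dx ⟨
    A ·ᵥ adj·nMinusR A n     ≡⟨ ·ᵥ-adj·nMinusR A n ⟩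
    det A ·ₛ nMinusR n       ∎)

-- The norm of α is nonzero

data Expr (n : ℕ) : Set where
  var : Fin n → Expr n
  con : ℤ → Expr n
  _:+_ _:-_ _:*_ : Expr n → Expr n → Expr n
  :-_ : Expr n → Expr n

infixl 6 _:+_ _:-_
infixl 7 _:*_
infix 8 :-_

⟦_⟧ : ∀ {n} → Expr n → Vec ℤ n → ℤ
⟦ var i ⟧   ρ = lookup ρ i
⟦ con z ⟧   ρ = z
⟦ e :+ e′ ⟧ ρ = ⟦ e ⟧ ρ + ⟦ e′ ⟧ ρ
⟦ e :- e′ ⟧ ρ = ⟦ e ⟧ ρ - ⟦ e′ ⟧ ρ
⟦ e :* e′ ⟧ ρ = ⟦ e ⟧ ρ * ⟦ e′ ⟧ ρ
⟦ :- e ⟧    ρ = - ⟦ e ⟧ ρ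

_≡ᵥ_[mod_] : ∀ {n} → Vec ℤ n → Vec ℤ n → ℤ → Set
ρ ≡ᵥ ρ′ [mod m ] = Pointwise (λ x y → m ∣ x - y) ρ ρ′

≡ᵥ-sym : ∀ {n m} {ρ ρ′ : Vec ℤ n} → ρ ≡ᵥ ρ′ [mod m ] → ρ′ ≡ᵥ ρ [mod m ]
≡ᵥ-sym = Pointwise.sym (λ {x} {y} → ∣m-n⇒∣n-m x y)

≡ᵥ-weaken : ∀ {n d m} {ρ ρ′ : Vec ℤ n} → d ∣ m → ρ ≡ᵥ ρ′ [mod m ] → ρ ≡ᵥ ρ′ [mod d ]
≡ᵥ-weaken d∣m = Pointwise.map (∣-trans d∣m)

⟦⟧-cong : ∀ {n m} (e : Expr n) {ρ ρ′} → ρ ≡ᵥ ρ′ [mod m ] → m ∣ ⟦ e ⟧ ρ - ⟦ e ⟧ ρ′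
⟦⟧-cong (var i) ρ≡ρ′ = Pointwise.lookup ρ≡ρ′ i
⟦⟧-cong (con z) _ = x≡y⇒∣x-y z z refl
⟦⟧-cong (e :+ e′) {ρ} {ρ′} ρ≡ρ′ = subst (_ ∣_) (identity (⟦ e ⟧ ρ) (⟦ e′ ⟧ ρ) (⟦ e ⟧ ρ′) (⟦ e′ ⟧ ρ′))
  (∣m∣n⇒∣m+n (⟦⟧-cong e ρ≡ρ′) (⟦⟧-cong e′ ρ≡ρ′))
  where
  identity : ∀ x y x′ y′ → (x - x′) + (y - y′) ≡ (x + y) - (x′ + y′)
  identity = solve-∀
⟦⟧-cong (e :- e′) {ρ} {ρ′} ρ≡ρ′ = subst (_ ∣_) (identity (⟦ e ⟧ ρ) (⟦ e′ ⟧ ρ) (⟦ e ⟧ ρ′) (⟦ e′ ⟧ ρ′))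
  (∣m∣n⇒∣m-n (⟦⟧-cong e ρ≡ρ′) (⟦⟧-cong e′ ρ≡ρ′))
  where
  identity : ∀ x y x′ y′ → (x - x′) - (y - y′) ≡ (x - y) - (x′ - y′)
  identity = solve-∀
⟦⟧-cong (e :* e′) {ρ} {ρ′} ρ≡ρ′ = subst (_ ∣_) (identity (⟦ e ⟧ ρ) (⟦ e′ ⟧ ρ) (⟦ e ⟧ ρ′) (⟦ e′ ⟧ ρ′))
  (∣m∣n⇒∣m+n (∣n⇒∣m*n (⟦ e ⟧ ρ) (⟦⟧-cong e′ ρ≡ρ′)) (∣m⇒∣m*n (⟦ e′ ⟧ ρ′) (⟦⟧-cong e ρ≡ρ′)))
  where
  identity : ∀ x y x′ y′ → x * (y - y′) + (x - x′) * y′ ≡ x * y - x′ * y′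
  identity = solve-∀
⟦⟧-cong (:- e) {ρ} {ρ′} ρ≡ρ′ = subst (_ ∣_) (identity (⟦ e ⟧ ρ) (⟦ e ⟧ ρ′)) (∣m⇒∣-m (⟦⟧-cong e ρ≡ρ′))
  where
  identity : ∀ x x′ → - (x - x′) ≡ - x - - x′
  identity = solve-∀

c₀ᴱ c₁ᴱ c₂ᴱ : ∀ {n} → Expr (3 ℕ.+ n)
c₀ᴱ = var 0F
c₁ᴱ = var 1F
c₂ᴱ = var 2F

a₀ᴱ a₁ᴱ a₂ᴱ : Expr 6
a₀ᴱ = var 3F
a₁ᴱ = var 4F
a₂ᴱ = var 5F

-- discᴱ, normᴱ and B₁₃ᴱ copy disc, norm and B₁₃ of Defs symbol for symbol, so that for instance
-- ⟦ normᴱ ⟧ (c₀ ∷ c₁ ∷ c₂ ∷ a₀ ∷ a₁ ∷ a₂ ∷ []) reduces to norm c₀ c₁ c₂ ⟨ a₀ , a₁ , a₂ ⟩.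
discᴱ f₁ᴱ : Expr 3
discᴱ = c₂ᴱ :* c₂ᴱ :* c₁ᴱ :* c₁ᴱ :- con (+ 4) :* c₁ᴱ :* c₁ᴱ :* c₁ᴱ :- con (+ 4) :* c₂ᴱ :* c₂ᴱ :* c₂ᴱ :* c₀ᴱ
        :- con (+ 27) :* c₀ᴱ :* c₀ᴱ :+ con (+ 18) :* c₂ᴱ :* c₁ᴱ :* c₀ᴱ
f₁ᴱ = con (+ 1) :+ c₂ᴱ :+ c₁ᴱ :+ c₀ᴱ

m₁₁ᴱ m₁₂ᴱ m₁₃ᴱ m₂₁ᴱ m₂₂ᴱ m₂₃ᴱ m₃₁ᴱ m₃₂ᴱ m₃₃ᴱ normᴱ B₁₃ᴱ : Expr 6
m₁₁ᴱ = a₀ᴱ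
m₁₂ᴱ = :- (c₀ᴱ :* a₂ᴱ)
m₁₃ᴱ = a₂ᴱ :* c₀ᴱ :* c₂ᴱ :- a₁ᴱ :* c₀ᴱ
m₂₁ᴱ = a₁ᴱ
m₂₂ᴱ = a₀ᴱ :- c₁ᴱ :* a₂ᴱ
m₂₃ᴱ = a₂ᴱ :* c₁ᴱ :* c₂ᴱ :- a₂ᴱ :* c₀ᴱ :- a₁ᴱ :* c₁ᴱ
m₃₁ᴱ = a₂ᴱ
m₃₂ᴱ = a₁ᴱ :- c₂ᴱ :* a₂ᴱ
m₃₃ᴱ = a₂ᴱ :* c₂ᴱ :* c₂ᴱ :- a₂ᴱ :* c₁ᴱ :- a₁ᴱ :* c₂ᴱ :+ a₀ᴱ
normᴱ = m₁₁ᴱ :* (m₂₂ᴱ :* m₃₃ᴱ :- m₂₃ᴱ :* m₃₂ᴱ) :- m₁₂ᴱ :* (m₂₁ᴱ :* m₃₃ᴱ :- m₂₃ᴱ :* m₃₁ᴱ)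
        :+ m₁₃ᴱ :* (m₂₁ᴱ :* m₃₂ᴱ :- m₂₂ᴱ :* m₃₁ᴱ)
B₁₃ᴱ  = m₂₁ᴱ :* m₃₂ᴱ :- m₂₂ᴱ :* m₃₁ᴱ

Odd : ℤ → Set
Odd z = ¬ (+ 2 ∣ z)

Odd? : ∀ z → Dec (Odd z)
Odd? z = ¬? (+ 2 ∣? z)

Odd-resp : ∀ {x y} → + 2 ∣ x - y → Odd y → Odd x
Odd-resp {x} {y} 2∣x-y odd-y 2∣x = odd-y (subst (_ ∣_) (identity x y) (∣m∣n⇒∣m-n 2∣x 2∣x-y))
  where
  identity : ∀ x y → x - (x - y) ≡ y
  identity = solve-∀

∣x∣≡1⇒Odd : ∀ {x} → ∣ x ∣ ≡ 1 → Odd x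
∣x∣≡1⇒Odd ∣x∣≡1 2∣x with ℕ.∣1⇒≡1 (subst (2 ℕ.∣_) ∣x∣≡1 (∣⇒∣ᵤ 2∣x))
... | ()

∣x∣≡1⇒x≡±1 : ∀ {x} → ∣ x ∣ ≡ 1 → x ≡ + 1 ⊎ x ≡ - + 1
∣x∣≡1⇒x≡±1 {+ 1}      refl = inj₁ refl
∣x∣≡1⇒x≡±1 { -[1+ 0 ]} refl = inj₂ refl

NoRootMod2 : ℤ → ℤ → ℤ → Set
NoRootMod2 c₀ c₁ c₂ = Odd c₀ × Odd (+ 1 + c₂ + c₁ + c₀)

NoRootMod2-resp : ∀ {c₀ c₁ c₂ c₀′ c₁′ c₂′} → (c₀ ∷ c₁ ∷ c₂ ∷ []) ≡ᵥ (c₀′ ∷ c₁′ ∷ c₂′ ∷ []) [mod + 2 ] →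
  NoRootMod2 c₀′ c₁′ c₂′ → NoRootMod2 c₀ c₁ c₂
NoRootMod2-resp c≡c′ (odd-c₀′ , odd-f₁′) =
  Odd-resp (⟦⟧-cong c₀ᴱ c≡c′) odd-c₀′ , Odd-resp (⟦⟧-cong f₁ᴱ c≡c′) odd-f₁′

-- By Stickelberger's parity theorem, Δ ≡ ±1 (mod 8) forces f mod 2 to have an odd number of irreducible
-- factors, and three distinct roots in F₂ are impossible, so f is irreducible mod 2.
disc≡±1⇒NoRootMod2-residues : ∀ (c₀ c₁ c₂ : Fin 8) →
  let c₀′ = + toℕ c₀; c₁′ = + toℕ c₁; c₂′ = + toℕ c₂; Δ = disc c₀′ c₁′ c₂′ in
  (+ 8 ∣ Δ - + 1) ⊎ (+ 8 ∣ Δ - - + 1) → NoRootMod2 c₀′ c₁′ c₂′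
disc≡±1⇒NoRootMod2-residues =
  toWitness {a? = all? λ c₀ → all? λ c₁ → all? λ c₂ → (_ ∣? _ ⊎-dec _ ∣? _) →-dec (Odd? _ ×-dec Odd? _)} _

NoRootMod2⇒Odd-norm-residues : ∀ (c₀ c₁ c₂ a₀ a₁ a₂ : Fin 2) →
  let c₀′ = + toℕ c₀; c₁′ = + toℕ c₁; c₂′ = + toℕ c₂; α = ⟨ + toℕ a₀ , + toℕ a₁ , + toℕ a₂ ⟩ in
  NoRootMod2 c₀′ c₁′ c₂′ → Odd (B₁₃ c₀′ c₁′ c₂′ α) → Odd (norm c₀′ c₁′ c₂′ α)
NoRootMod2⇒Odd-norm-residues =
  toWitness {a? = all? λ c₀ → all? λ c₁ → all? λ c₂ → all? λ a₀ → all? λ a₁ → all? λ a₂ →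
    (Odd? _ ×-dec Odd? _) →-dec Odd? _ →-dec Odd? _} _

∣disc∣≡1⇒NoRootMod2 : ∀ c₀ c₁ c₂ → ∣ disc c₀ c₁ c₂ ∣ ≡ 1 → NoRootMod2 c₀ c₁ c₂
∣disc∣≡1⇒NoRootMod2 c₀ c₁ c₂ ∣Δ∣≡1 with residue 8 c₀ | residue 8 c₁ | residue 8 c₂
... | r₀ , c₀≡r₀ | r₁ , c₁≡r₁ | r₂ , c₂≡r₂ =
  NoRootMod2-resp (≡ᵥ-weaken (divides (+ 4) refl) c≡r)
    (disc≡±1⇒NoRootMod2-residues r₀ r₁ r₂ (Sum.map (transfer (+ 1)) (transfer (- + 1)) Δ≡±1))
  where
  c≡r : (c₀ ∷ c₁ ∷ c₂ ∷ []) ≡ᵥ (+ toℕ r₀ ∷ + toℕ r₁ ∷ + toℕ r₂ ∷ []) [mod + 8 ]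
  c≡r = c₀≡r₀ ∷ c₁≡r₁ ∷ c₂≡r₂ ∷ []
  transfer : ∀ ε → + 8 ∣ disc c₀ c₁ c₂ - ε → + 8 ∣ disc (+ toℕ r₀) (+ toℕ r₁) (+ toℕ r₂) - ε
  transfer ε = ∣m-n∣n-o⇒∣m-o Δ̄ Δ ε (∣m-n⇒∣n-m Δ Δ̄ (⟦⟧-cong discᴱ c≡r))
    where
    Δ Δ̄ : ℤ
    Δ = disc c₀ c₁ c₂
    Δ̄ = disc (+ toℕ r₀) (+ toℕ r₁) (+ toℕ r₂)
  Δ≡±1 : (+ 8 ∣ disc c₀ c₁ c₂ - + 1) ⊎ (+ 8 ∣ disc c₀ c₁ c₂ - - + 1)
  Δ≡±1 = Sum.map (x≡y⇒∣x-y _ (+ 1)) (x≡y⇒∣x-y _ (- + 1)) (∣x∣≡1⇒x≡±1 {disc c₀ c₁ c₂} ∣Δ∣≡1)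

NoRootMod2⇒Odd-norm : ∀ c₀ c₁ c₂ α → NoRootMod2 c₀ c₁ c₂ → Odd (B₁₃ c₀ c₁ c₂ α) → Odd (norm c₀ c₁ c₂ α)
NoRootMod2⇒Odd-norm c₀ c₁ c₂ ⟨ a₀ , a₁ , a₂ ⟩ noRoot odd-B
  with residue 2 c₀ | residue 2 c₁ | residue 2 c₂ | residue 2 a₀ | residue 2 a₁ | residue 2 a₂
... | r₀ , c₀≡r₀ | r₁ , c₁≡r₁ | r₂ , c₂≡r₂ | s₀ , a₀≡s₀ | s₁ , a₁≡s₁ | s₂ , a₂≡s₂ =
  Odd-resp (⟦⟧-cong normᴱ ρ≡ρ̄) (NoRootMod2⇒Odd-norm-residues r₀ r₁ r₂ s₀ s₁ s₂
    (NoRootMod2-resp (≡ᵥ-sym c≡r) noRoot)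
    (Odd-resp (⟦⟧-cong B₁₃ᴱ (≡ᵥ-sym ρ≡ρ̄)) odd-B))
  where
  ρ≡ρ̄ : (c₀ ∷ c₁ ∷ c₂ ∷ a₀ ∷ a₁ ∷ a₂ ∷ [])
     ≡ᵥ (+ toℕ r₀ ∷ + toℕ r₁ ∷ + toℕ r₂ ∷ + toℕ s₀ ∷ + toℕ s₁ ∷ + toℕ s₂ ∷ []) [mod + 2 ]
  ρ≡ρ̄ = c₀≡r₀ ∷ c₁≡r₁ ∷ c₂≡r₂ ∷ a₀≡s₀ ∷ a₁≡s₁ ∷ a₂≡s₂ ∷ []
  c≡r : (c₀ ∷ c₁ ∷ c₂ ∷ []) ≡ᵥ (+ toℕ r₀ ∷ + toℕ r₁ ∷ + toℕ r₂ ∷ []) [mod + 2 ]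
  c≡r = c₀≡r₀ ∷ c₁≡r₁ ∷ c₂≡r₂ ∷ []

norm≢0 : ∀ c₀ c₁ c₂ α → Coprime ∣ norm c₀ c₁ c₂ α ∣ ∣ B₁₃ c₀ c₁ c₂ α * disc c₀ c₁ c₂ ∣ →
  norm c₀ c₁ c₂ α ≢ + 0
norm≢0 c₀ c₁ c₂ α cop N≡0 = odd-N (subst (+ 2 ∣_) (sym N≡0) (divides (+ 0) refl))
  where
  ∣B∣∣Δ∣≡1 : ∣ B₁₃ c₀ c₁ c₂ α ∣ ℕ.* ∣ disc c₀ c₁ c₂ ∣ ≡ 1
  ∣B∣∣Δ∣≡1 = trans (sym (abs-* (B₁₃ c₀ c₁ c₂ α) (disc c₀ c₁ c₂)))
    (0-coprimeTo-m⇒m≡1 (subst (λ N → Coprime ∣ N ∣ ∣ B₁₃ c₀ c₁ c₂ α * disc c₀ c₁ c₂ ∣) N≡0 cop))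
  odd-N : Odd (norm c₀ c₁ c₂ α)
  odd-N = NoRootMod2⇒Odd-norm c₀ c₁ c₂ α
    (∣disc∣≡1⇒NoRootMod2 c₀ c₁ c₂ (ℕ.m*n≡1⇒n≡1 ∣ B₁₃ c₀ c₁ c₂ α ∣ ∣ disc c₀ c₁ c₂ ∣ ∣B∣∣Δ∣≡1))
    (∣x∣≡1⇒Odd (ℕ.m*n≡1⇒m≡1 ∣ B₁₃ c₀ c₁ c₂ α ∣ ∣ disc c₀ c₁ c₂ ∣ ∣B∣∣Δ∣≡1))

-- Ideals of ℤ[r] containing k − r

ι : ℤ → Zr
ι n = ⟨ n , + 0 , + 0 ⟩

evalAt : ℤ → Zr → ℤ
evalAt k ⟨ x₀ , x₁ , x₂ ⟩ = x₀ + x₁ * k + x₂ * k * k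

module _ (c₀ c₁ c₂ : ℤ) {J : Zr → Set} (J-ideal : IsIdeal c₀ c₁ c₂ J) where
  open IsIdeal J-ideal

  private
    infixl 7 _⋆_
    _⋆_ : Zr → Zr → Zr
    _⋆_ = _·_ c₀ c₁ c₂

  ι-⋆ : ∀ m x → ι m ⋆ x ≡ m ·ₛ x
  ι-⋆ m ⟨ x₀ , x₁ , x₂ ⟩ =
    cong₃ (row₁ m c₀ c₂ x₀ x₁ x₂) (row₂ m c₀ c₁ c₂ x₀ x₁ x₂) (row₃ m c₁ c₂ x₀ x₁ x₂)
    where
    row₁ : ∀ m c₀ c₂ x₀ x₁ x₂ →
      m * x₀ + - (c₀ * + 0) * x₁ + (+ 0 * c₀ * c₂ - + 0 * c₀) * x₂ ≡ m * x₀
    row₁ = solve-∀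
    row₂ : ∀ m c₀ c₁ c₂ x₀ x₁ x₂ →
      + 0 * x₀ + (m - c₁ * + 0) * x₁ + (+ 0 * c₁ * c₂ - + 0 * c₀ - + 0 * c₁) * x₂ ≡ m * x₁
    row₂ = solve-∀
    row₃ : ∀ m c₁ c₂ x₀ x₁ x₂ →
      + 0 * x₀ + (+ 0 - c₂ * + 0) * x₁ + (+ 0 * c₂ * c₂ - + 0 * c₁ - + 0 * c₂ + m) * x₂ ≡ m * x₂
    row₃ = solve-∀

  ∈-·ₛ : ∀ m {x} → J x → J (m ·ₛ x)
  ∈-·ₛ m {x} x∈J = subst J (ι-⋆ m x) (·∈ (ι m) x x∈J)

  ∈-⊖ : ∀ {x y} → J x → J y → J (x ⊖ y)
  ∈-⊖ {x} {y} x∈J y∈J = subst J (identity x y) (+∈ x (- + 1 ·ₛ y) x∈J (∈-·ₛ (- + 1) y∈J))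
    where
    coordinate : ∀ a b → a + - + 1 * b ≡ a - b
    coordinate = solve-∀
    identity : ∀ x y → x ⊕ (- + 1 ·ₛ y) ≡ x ⊖ y
    identity ⟨ x₀ , x₁ , x₂ ⟩ ⟨ y₀ , y₁ , y₂ ⟩ = cong₃ (coordinate x₀ y₀) (coordinate x₁ y₁) (coordinate x₂ y₂)

  ∈⇔⊖∈ : ∀ {x y} → J y → J x ⇔ J (x ⊖ y)
  ∈⇔⊖∈ {x} {y} y∈J =
    mk⇔ (λ x∈J → ∈-⊖ x∈J y∈J) (λ x-y∈J → subst J (identity x y) (+∈ (x ⊖ y) y x-y∈J y∈J))
    where
    coordinate : ∀ a b → a - b + b ≡ a
    coordinate = solve-∀
    identity : ∀ x y → (x ⊖ y) ⊕ y ≡ x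
    identity ⟨ x₀ , x₁ , x₂ ⟩ ⟨ y₀ , y₁ , y₂ ⟩ = cong₃ (coordinate x₀ y₀) (coordinate x₁ y₁) (coordinate x₂ y₂)

  ⊖∈-sym : ∀ x y → J (x ⊖ y) → J (y ⊖ x)
  ⊖∈-sym x y x-y∈J = subst J (identity x y) (∈-·ₛ (- + 1) x-y∈J)
    where
    coordinate : ∀ a b → - + 1 * (a - b) ≡ b - a
    coordinate = solve-∀
    identity : ∀ x y → - + 1 ·ₛ (x ⊖ y) ≡ y ⊖ x
    identity ⟨ x₀ , x₁ , x₂ ⟩ ⟨ y₀ , y₁ , y₂ ⟩ = cong₃ (coordinate x₀ y₀) (coordinate x₁ y₁) (coordinate x₂ y₂)

  ⊖∈-trans : ∀ x y z → J (x ⊖ y) → J (y ⊖ z) → J (x ⊖ z)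
  ⊖∈-trans x y z x-y∈J y-z∈J = subst J (identity x y z) (+∈ (x ⊖ y) (y ⊖ z) x-y∈J y-z∈J)
    where
    coordinate : ∀ a b c → a - b + (b - c) ≡ a - c
    coordinate = solve-∀
    identity : ∀ x y z → (x ⊖ y) ⊕ (y ⊖ z) ≡ x ⊖ z
    identity ⟨ x₀ , x₁ , x₂ ⟩ ⟨ y₀ , y₁ , y₂ ⟩ ⟨ z₀ , z₁ , z₂ ⟩ =
      cong₃ (coordinate x₀ y₀ z₀) (coordinate x₁ y₁ z₁) (coordinate x₂ y₂ z₂)

  ι∈-∣ : ∀ {d z} → d ∣ z → J (ι d) → J (ι z)
  ι∈-∣ {d} (divides q refl) d∈J = subst J (cong₃ refl (*-zeroʳ q) (*-zeroʳ q)) (∈-·ₛ q d∈J)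

  module _ (k : ℤ) (k-r∈J : J (nMinusR k)) where

    -- x(r) − x(k) = (k − r)·(−(x₁ + x₂k) − x₂r).
    ⊖ι-evalAt∈ : ∀ x → J (x ⊖ ι (evalAt k x))
    ⊖ι-evalAt∈ ⟨ x₀ , x₁ , x₂ ⟩ =
      subst J (cong₃ (row₁ x₀ x₁ x₂ k c₀ c₂) (row₂ x₁ x₂ k c₀ c₁ c₂) (row₃ x₁ x₂ k c₀ c₁ c₂))
        (·∈ ⟨ - (x₁ + x₂ * k) , - x₂ , + 0 ⟩ (nMinusR k) k-r∈J)
      where
      row₁ : ∀ x₀ x₁ x₂ k c₀ c₂ →
          - (x₁ + x₂ * k) * k + - (c₀ * + 0) * - + 1 + (+ 0 * c₀ * c₂ - - x₂ * c₀) * + 0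
        ≡ x₀ - (x₀ + x₁ * k + x₂ * k * k)
      row₁ = solve-∀
      row₂ : ∀ x₁ x₂ k c₀ c₁ c₂ →
          - x₂ * k + (- (x₁ + x₂ * k) - c₁ * + 0) * - + 1 + (+ 0 * c₁ * c₂ - + 0 * c₀ - - x₂ * c₁) * + 0
        ≡ x₁ - + 0
      row₂ = solve-∀
      row₃ : ∀ x₁ x₂ k c₀ c₁ c₂ →
          + 0 * k + (- x₂ - c₂ * + 0) * - + 1 + (+ 0 * c₂ * c₂ - + 0 * c₁ - - x₂ * c₂ + - (x₁ + x₂ * k)) * + 0
        ≡ x₂ - + 0
      row₃ = solve-∀

    module _ (NJ : ℕ) (index : HasIndex c₀ c₁ c₂ J NJ) where
      private
        g : Fin NJ → Zr
        g = proj₁ index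
        class : ∀ x → ∃ λ i → J (x ⊖ g i)
        class = proj₁ (proj₂ index)
        distinct : ∀ i j → J (g i ⊖ g j) → i ≡ j
        distinct = proj₂ (proj₂ index)

      index≤ : ∀ d .{{_ : ℕ.NonZero d}} → J (ι (+ d)) → NJ ℕ.≤ d
      index≤ d d∈J = injective⇒≤ {f = residueAt} residueAt-injective
        where
        residueAt : Fin NJ → Fin d
        residueAt i = proj₁ (residue d (evalAt k (g i)))
        residueAt-injective : ∀ {i j} → residueAt i ≡ residueAt j → i ≡ j
        residueAt-injective {i} {j} same = distinct i j
          (⊖∈-trans (g i) (ι tᵢ) (g j) (⊖ι-evalAt∈ (g i))
            (⊖∈-trans (ι tᵢ) (ι tⱼ) (g j) (ι∈-∣ d∣tᵢ-tⱼ d∈J)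
              (⊖∈-sym (g j) (ι tⱼ) (⊖ι-evalAt∈ (g j)))))
          where
          tᵢ tⱼ : ℤ
          tᵢ = evalAt k (g i)
          tⱼ = evalAt k (g j)
          d∣tᵢ-tⱼ : + d ∣ tᵢ - tⱼ
          d∣tᵢ-tⱼ = ∣m-n∣n-o⇒∣m-o tᵢ (+ toℕ (residueAt i)) tⱼ (proj₂ (residue d tᵢ))
            (∣m-n⇒∣n-m tⱼ _ (subst (λ r → + d ∣ tⱼ - + toℕ r) (sym same) (proj₂ (residue d tⱼ))))

      positive∈ : ∃ λ d → ℕ.NonZero d × d ℕ.≤ NJ × J (ι (+ d))
      positive∈ with pigeonhole (ℕ.n<1+n NJ) (λ (i : Fin (suc NJ)) → proj₁ (class (ι (+ toℕ i))))
      ... | i , j , i<j , same = toℕ j ℕ.∸ toℕ i , ℕ.>-nonZero (ℕ.m<n⇒0<n∸m i<j) ,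
        ℕ.≤-trans (ℕ.m∸n≤m (toℕ j) (toℕ i)) (ℕ.≤-pred (toℕ<n j)) ,
        subst (λ z → J (ι z)) (trans ([+m]-[+n]≡m⊖n (toℕ j) (toℕ i)) (⊖-≥ (ℕ.<⇒≤ i<j)))
          (⊖∈-trans (ι (+ toℕ j)) (g cⱼ) (ι (+ toℕ i)) (proj₂ (class (ι (+ toℕ j))))
            (⊖∈-sym (ι (+ toℕ i)) (g cⱼ)
              (subst (λ c → J (ι (+ toℕ i) ⊖ g c)) same (proj₂ (class (ι (+ toℕ i)))))))
        where
        cⱼ : Fin NJ
        cⱼ = proj₁ (class (ι (+ toℕ j)))

      NJ∈ : J (ι (+ NJ))
      NJ∈ with positive∈
      ... | d , d≢0 , d≤NJ , d∈J = subst (λ m → J (ι (+ m))) (ℕ.≤-antisym d≤NJ (index≤ d {{d≢0}} d∈J)) d∈J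

      instance
        NJ≢0 : ℕ.NonZero NJ
        NJ≢0 = nonZeroIndex (proj₁ (class zeroZr))

      ι∈⇔ : ∀ z → J (ι z) ⇔ + NJ ∣ z
      ι∈⇔ z = mk⇔ multiple (λ NJ∣z → ι∈-∣ NJ∣z NJ∈)
        where
        remainder-zero : ∀ m → m ℕ.< NJ → J (ι (+ m)) → + NJ ∣ z - + m → + NJ ∣ z
        remainder-zero zero    _    _   NJ∣z-0 = subst (+ NJ ∣_) (+-identityʳ z) NJ∣z-0
        remainder-zero (suc m) m<NJ m∈J _      = ⊥-elim (ℕ.<⇒≱ m<NJ (index≤ (suc m) m∈J))
        multiple : J (ι z) → + NJ ∣ z
        multiple z∈J = fromResidue (residue NJ z)
          where
          identity : ∀ z r → z - (z - r) ≡ r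
          identity = solve-∀
          fromResidue : (∃ λ (r : Fin NJ) → + NJ ∣ z - + toℕ r) → + NJ ∣ z
          fromResidue (r , NJ∣z-r) = remainder-zero (toℕ r) (toℕ<n r)
            (subst (λ t → J (ι t)) (identity z (+ toℕ r)) (∈-⊖ z∈J (ι∈-∣ NJ∣z-r NJ∈))) NJ∣z-r

      nMinusR∈⇔ : ∀ n → J (nMinusR n) ⇔ + NJ ∣ n - k
      nMinusR∈⇔ n = ⇔-trans (∈⇔⊖∈ k-r∈J) (ι∈⇔ (n - k))

      nMinusR∈⇔≡residue : ∃ λ kJ → (+ 0 ≤ kJ × kJ < + NJ) × (∀ n → J (nMinusR n) ⇔ (n ≡ kJ [mod + NJ ]))
      nMinusR∈⇔≡residue = fromResidue (residue NJ k)
        where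
        fromResidue : (∃ λ (r : Fin NJ) → + NJ ∣ k - + toℕ r) →
          ∃ λ kJ → (+ 0 ≤ kJ × kJ < + NJ) × (∀ n → J (nMinusR n) ⇔ (n ≡ kJ [mod + NJ ]))
        fromResidue (r , NJ∣k-r) = + toℕ r , +toℕ-bounds r , λ n →
          ⇔-trans (nMinusR∈⇔ n)
          (⇔-trans (∣m-n⇒∣o-m⇔∣o-n k (+ toℕ r) n NJ∣k-r)
                   (⇔-sym (≡mod⇔∣ n (+ toℕ r) (+ NJ))))

-- The residue of r modulo α

matrixOf : (Fin 3 → Fin 3 → ℤ) → Matrix₃
matrixOf A = matrix (A 0F 0F) (A 0F 1F) (A 0F 2F) (A 1F 0F) (A 1F 1F) (A 1F 2F) (A 2F 0F) (A 2F 1F) (A 2F 2F)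

module _ (c₀ c₁ c₂ : ℤ) (α : Zr) (cop : Coprime ∣ norm c₀ c₁ c₂ α ∣ ∣ B₁₃ c₀ c₁ c₂ α * disc c₀ c₁ c₂ ∣) where
  private
    N B₁₃α B₂₃α : ℤ
    N = norm c₀ c₁ c₂ α
    B₁₃α = B₁₃ c₀ c₁ c₂ α
    B₂₃α = B₂₃ c₀ c₁ c₂ α
    instance
      N≢0 : NonZero N
      N≢0 = ≢-nonZero (norm≢0 c₀ c₁ c₂ α cop)
    N⊥B₁₃α : Coprime ∣ N ∣ ∣ B₁₃α ∣
    N⊥B₁₃α = coprime-*ʳ⇒coprime N B₁₃α (disc c₀ c₁ c₂) cop
    ū : ℤ
    ū = proj₁ (coprime⇒inverse N B₁₃α N⊥B₁₃α)
    N∣B₁₃αū-1 : N ∣ B₁₃α * ū - + 1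
    N∣B₁₃αū-1 = proj₂ (coprime⇒inverse N B₁₃α N⊥B₁₃α)

  k̂ : Fin ∣ N ∣
  k̂ = proj₁ (residue ∣ N ∣ (B₂₃α * ū))

  private
    k : ℤ
    k = + toℕ k̂
    N∣B₂₃αū-k : N ∣ B₂₃α * ū - k
    N∣B₂₃αū-k = ∣-trans m∣∣m∣ (proj₂ (residue ∣ N ∣ (B₂₃α * ū)))

  divides⇔≡k : ∀ n → DividesZr c₀ c₁ c₂ α (nMinusR n) ⇔ (n ≡ k [mod N ])
  divides⇔≡k n =
    ⇔-trans (solvable⇔ (matrixOf (M c₀ c₁ c₂ α)) n N⊥B₁₃α)
    (⇔-trans (unit-∣⇔ B₁₃α ū B₂₃α n N∣B₁₃αū-1)
    (⇔-trans (∣m-n⇒∣o-m⇔∣o-n (B₂₃α * ū) k n N∣B₂₃αū-k)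
             (⇔-sym (≡mod⇔∣ n k N))))

  α∣k-r : DividesZr c₀ c₁ c₂ α (nMinusR k)
  α∣k-r = from (divides⇔≡k k) (from (≡mod⇔∣ k k N) (x≡y⇒∣x-y k k refl))

  k≡B₂₃b̄ : ∀ b̄ → B₁₃α * b̄ ≡ + 1 [mod N ] → k ≡ B₂₃α * b̄ [mod N ]
  k≡B₂₃b̄ b̄ B₁₃αb̄≡1 = from (≡mod⇔∣ k (B₂₃α * b̄) N)
    (to (unit-∣⇔ B₁₃α b̄ B₂₃α k (to (≡mod⇔∣ (B₁₃α * b̄) (+ 1) N) B₁₃αb̄≡1))
      (from (unit-∣⇔ B₁₃α ū B₂₃α k N∣B₁₃αū-1) (∣m-n⇒∣n-m (B₂₃α * ū) k N∣B₂₃αū-k)))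

lemma5 : (c₀ c₁ c₂ : ℤ) → IrreducibleZ (cubic c₀ c₁ c₂) →
    (α : Zr) →
    Coprime ∣ norm c₀ c₁ c₂ α ∣ ∣ B₁₃ c₀ c₁ c₂ α * disc c₀ c₁ c₂ ∣ →
    (∃ λ (k : ℤ) →
        (+ 0 ≤ k × k < + ∣ norm c₀ c₁ c₂ α ∣)
      × (∀ (n : ℤ) → DividesZr c₀ c₁ c₂ α (nMinusR n) ⇔ (n ≡ k [mod norm c₀ c₁ c₂ α ]))
      × (∀ (b̄ : ℤ) → B₁₃ c₀ c₁ c₂ α * b̄ ≡ + 1 [mod norm c₀ c₁ c₂ α ] →
           k ≡ B₂₃ c₀ c₁ c₂ α * b̄ [mod norm c₀ c₁ c₂ α ]))
    × (∀ (J : Zr → Set) → IsIdeal c₀ c₁ c₂ J →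
         (∀ β → J (_·_ c₀ c₁ c₂ α β)) →
         ∀ (NJ : ℕ) → HasIndex c₀ c₁ c₂ J NJ →
         ∃ λ (k : ℤ) → (+ 0 ≤ k × k < + NJ)
           × (∀ (n : ℤ) → J (nMinusR n) ⇔ (n ≡ k [mod + NJ ])))
lemma5 c₀ c₁ c₂ _ α cop =
  (+ toℕ k , +toℕ-bounds k , divides⇔≡k c₀ c₁ c₂ α cop , k≡B₂₃b̄ c₀ c₁ c₂ α cop) ,
  λ J J-ideal α∈J NJ index →
    nMinusR∈⇔≡residue c₀ c₁ c₂ J-ideal (+ toℕ k) (k-r∈ J α∈J (α∣k-r c₀ c₁ c₂ α cop)) NJ index
  where
  k : Fin ∣ norm c₀ c₁ c₂ α ∣
  k = k̂ c₀ c₁ c₂ α cop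
  k-r∈ : ∀ J → (∀ β → J (_·_ c₀ c₁ c₂ α β)) → DividesZr c₀ c₁ c₂ α (nMinusR (+ toℕ k)) → J (nMinusR (+ toℕ k))
  k-r∈ J α∈J (β , αβ≡k-r) = subst J αβ≡k-r (α∈J β)
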